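{- Let $P,Q,R$ be cones, $p\in\mathbb N$, $f,h_1,\dots,h_p:\mathcal BP\to Q$ pre-stable from $P$ to $Q$ and $g:\mathcal BQ\to R$ pre-stable from $Q$ to $R$, such that $f(x)+\sum_{i=1}^ph_i(x)\in\mathcal BQ$ for all $x\in\mathcal BP$. Then the function $k:\mathcal BP\to R$, $k(x)=\Delta g(f(x);h_1(x),\dots,h_p(x))$, is pre-stable from $P$ to $R$.
   Context: A cone is an $\mathbb R_{\ge0}$-semimodule $P$ with $\|\cdot\|_P$ such that: $x+y=x+y'\Rightarrow y=y'$; $\|\alpha x\|=\alpha\|x\|$; $\|x\|=0\Rightarrow x=0$; $\|x+x'\|\le\|x\|+\|x'\|$; $\|x\|\le\|x+x'\|$. $\mathcal BP=\{x:\|x\|\le1\}$; cone order $x\le x'$ iff $x'=x+y$ for a (unique) $y=x'-x$. For $g:\mathcal BQ\to R$, $\vec v\in Q^n$ and $y$ with $y+\sum v_i\in\mathcal BQ$, $\Delta^\epsilon g(y;\vec v)=\sum_{I\in\mathcal C^\epsilon_n}g(y+\sum_{i\in I}v_i)$, where $\mathcal C^+_n$ (resp. $\mathcal C^-_n$) is the set of $I\subseteq\{1,\dots,n\}$ with $n-|I|$ even (resp. odd). $g$ is pre-stable if $\Delta^-g(y;\vec v)\le\Delta^+g(y;\vec v)$ for all $n\ge1$ and all such $\vec v,y$; then $\Delta g(y;\vec v)=\Delta^+g(y;\vec v)-\Delta^-g(y;\vec v)$ (for $n=0$, $\Delta g(y;)=g(y)$). -}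

module Defs where

open import Data.Nat using (ℕ; zero; suc)
open import Data.Bool using (Bool; true; false; not)
open import Data.Vec using (Vec; []; _∷_)
open import Data.Product using (∃; _×_; _,_; proj₁)
open import Relation.Nullary using (¬_)
open import Relation.Binary.PropositionalEquality
  using (_≡_; refl; sym; trans; cong; subst)
open import Algebra.Structures using (IsCommutativeRing)
open import Relation.Binary.Structures using (IsTotalOrder)

-- The real numbers, axiomatised as a Dedekind-complete ordered field
-- (agda-stdlib has no reals; every model is isomorphic to ℝ).

record Reals : Set₁ where
  infixl 6 _+_
  infixl 7 _*_
  infix 4 _≤_
  field
    ℝ : Set
    _+_ _*_ : ℝ → ℝ → ℝ
    -_ : ℝ → ℝ
    0r 1r : ℝ
    _≤_ : ℝ → ℝ → Set
    isCommutativeRing : IsCommutativeRing _≡_ _+_ _*_ -_ 0r 1r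
    0≢1 : ¬ (0r ≡ 1r)
    inv : (x : ℝ) → ¬ (x ≡ 0r) → ℝ
    inv-cancel : ∀ x (x≢0 : ¬ (x ≡ 0r)) → x * inv x x≢0 ≡ 1r
    isTotalOrder : IsTotalOrder _≡_ _≤_
    +-mono-≤ : ∀ {a b} c → a ≤ b → a + c ≤ b + c
    *-nonneg : ∀ {a b} → 0r ≤ a → 0r ≤ b → 0r ≤ a * b
    0≤1 : 0r ≤ 1r
    complete : (S : ℝ → Set) → ∃ S → ∃ (λ b → ∀ s → S s → s ≤ b) →
               ∃ λ u → (∀ s → S s → s ≤ u) × (∀ b → (∀ s → S s → s ≤ b) → u ≤ b)

module _ (ℛ : Reals) where
  open Reals ℛ

  ≤-trans : ∀ {a b c} → a ≤ b → b ≤ c → a ≤ c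
  ≤-trans = IsTotalOrder.trans isTotalOrder

  ≤-refl : ∀ {a} → a ≤ a
  ≤-refl = IsTotalOrder.refl isTotalOrder

  +-nonneg : ∀ {a b} → 0r ≤ a → 0r ≤ b → 0r ≤ a + b
  +-nonneg {a} {b} 0≤a 0≤b =
    ≤-trans 0≤b (subst (_≤ a + b) (IsCommutativeRing.+-identityˡ isCommutativeRing b) (+-mono-≤ b 0≤a))

  record ℝ≥0 : Set where
    constructor _,≥0_
    field
      val : ℝ
      .nonneg : 0r ≤ val
  open ℝ≥0 public

  _+≥0_ : ℝ≥0 → ℝ≥0 → ℝ≥0
  (a ,≥0 p) +≥0 (b ,≥0 q) = (a + b) ,≥0 +-nonneg p q

  _*≥0_ : ℝ≥0 → ℝ≥0 → ℝ≥0
  (a ,≥0 p) *≥0 (b ,≥0 q) = (a * b) ,≥0 *-nonneg p q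

  0≥0 1≥0 : ℝ≥0
  0≥0 = 0r ,≥0 ≤-refl
  1≥0 = 1r ,≥0 0≤1

  record Cone : Set₁ where
    infixl 6 _⊕_
    infixr 7 _·_
    field
      C : Set
      _⊕_ : C → C → C
      𝟎 : C
      _·_ : ℝ≥0 → C → C
      ‖_‖ : C → ℝ≥0
      ⊕-assoc : ∀ x y z → (x ⊕ y) ⊕ z ≡ x ⊕ (y ⊕ z)
      ⊕-comm : ∀ x y → x ⊕ y ≡ y ⊕ x
      ⊕-identityˡ : ∀ x → 𝟎 ⊕ x ≡ x
      ·-distribˡ : ∀ α x y → α · (x ⊕ y) ≡ α · x ⊕ α · y
      ·-distribʳ : ∀ α β x → (α +≥0 β) · x ≡ α · x ⊕ β · x
      ·-assoc : ∀ α β x → (α *≥0 β) · x ≡ α · (β · x)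
      ·-identity : ∀ x → 1≥0 · x ≡ x
      ·-zeroˡ : ∀ x → 0≥0 · x ≡ 𝟎
      ·-zeroʳ : ∀ α → α · 𝟎 ≡ 𝟎
      cancel : ∀ x y y' → x ⊕ y ≡ x ⊕ y' → y ≡ y'
      norm-homog : ∀ α x → val ‖ α · x ‖ ≡ val α * val ‖ x ‖
      norm-definite : ∀ x → val ‖ x ‖ ≡ 0r → x ≡ 𝟎
      norm-triangle : ∀ x x' → val ‖ x ⊕ x' ‖ ≤ val ‖ x ‖ + val ‖ x' ‖
      norm-mono : ∀ x x' → val ‖ x ‖ ≤ val ‖ x ⊕ x' ‖

  InBall : (P : Cone) → Cone.C P → Set
  InBall P x = val (Cone.‖_‖ P x) ≤ 1r

  -- 𝓑P as a type (the proof of membership is irrelevant, so functions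
  -- on 𝓑P cannot depend on it)
  record Ball (P : Cone) : Set where
    constructor ball
    field
      pt : Cone.C P
      .inBall : InBall P pt

  module _ (P : Cone) where
    open Cone P

    _≼_ : C → C → Set
    x ≼ x' = ∃ λ y → x' ≡ x ⊕ y

    _+Σ_ : ∀ {n} → C → Vec C n → C
    y +Σ [] = y
    y +Σ (v ∷ vs) = (y ⊕ v) +Σ vs

    swap : ∀ y z v → (y ⊕ z) ⊕ v ≡ (y ⊕ v) ⊕ z
    swap y z v = trans (⊕-assoc y z v)
                   (trans (cong (y ⊕_) (⊕-comm z v)) (sym (⊕-assoc y v z)))

    shift : ∀ {n} y z (vs : Vec C n) → (y ⊕ z) +Σ vs ≡ (y +Σ vs) ⊕ z
    shift y z [] = refl
    shift y z (v ∷ vs) = trans (cong (_+Σ vs) (swap y z v)) (shift (y ⊕ v) z vs)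

    excl : ∀ {n} y v (vs : Vec C n) → InBall P (y +Σ (v ∷ vs)) → InBall P (y +Σ vs)
    excl y v vs m =
      ≤-trans (subst (λ t → val ‖ y +Σ vs ‖ ≤ val ‖ t ‖) (sym (shift y v vs))
                     (norm-mono (y +Σ vs) v)) m

  -- Δ^±: Δ± g b y v m is the sum over I ⊆ {1..n} with n - |I| even
  -- (b = true, Δ⁺) resp. odd (b = false, Δ⁻) of g(y + Σ_{i∈I} vᵢ).
  -- Recursion on the first vector: either 1 ∉ I (parity of the remaining
  -- n-1 flips) or 1 ∈ I (base point y+v₁, same parity).
  module _ {Q R : Cone} (g : Ball Q → Cone.C R) where
    open Cone Q

    Δ± : Bool → ∀ {n} (y : C) (v : Vec C n) → .(InBall Q (_+Σ_ Q y v)) → Cone.C R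
    Δ± true  y [] m = g (ball y m)
    Δ± false y [] m = Cone.𝟎 R
    Δ± b y (v ∷ vs) m = Cone._⊕_ R (Δ± (not b) y vs (excl Q y v vs m)) (Δ± b (y ⊕ v) vs m)

    Δ⁺ Δ⁻ : ∀ {n} (y : C) (v : Vec C n) → .(InBall Q (_+Σ_ Q y v)) → Cone.C R
    Δ⁺ = Δ± true
    Δ⁻ = Δ± false

  PreStable : (Q R : Cone) → (Ball Q → Cone.C R) → Set
  PreStable Q R g = ∀ {n} (y : Cone.C Q) (v : Vec (Cone.C Q) (suc n))
    .(m : InBall Q (_+Σ_ Q y v)) → _≼_ R (Δ⁻ {Q} {R} g y v m) (Δ⁺ {Q} {R} g y v m)

  -- Δ g (y; v) = Δ⁺ - Δ⁻ (the unique difference, by cancellativity);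
  -- Δ g (y;) = g y for n = 0.
  Δ : {Q R : Cone} (g : Ball Q → Cone.C R) → PreStable Q R g →
      ∀ {n} (y : Cone.C Q) (v : Vec (Cone.C Q) n) → .(InBall Q (_+Σ_ Q y v)) → Cone.C R
  Δ g ps y [] m = g (ball y m)
  Δ g ps y (v ∷ vs) m = proj₁ (ps y (v ∷ vs) m)

module Submission where

-- Pre-stability of k is checked one order at a time: k is pre-stable of order n + 1 as soon as
-- every increment x ↦ k (x + u) − k x is pre-stable of order n.  Pre-stability of f and of the hᵢ
-- gives increments f (x + u) = f x + a x and hᵢ (x + u) = hᵢ x + bᵢ x with a and bᵢ pre-stable,
-- and the identities
--   Δg (y + a; v⃗) = Δg (y; v⃗) + Δg (y; a, v⃗),
--   Δg (y; h + b, v⃗) = Δg (y; h, v⃗) + Δg (y; b, v⃗) + Δg (y; h, b, v⃗)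
-- expand k (x + u) into k x plus a finite sum of maps of the same shape x ↦ Δg (f x; w⃗ x), each wⱼ
-- being one of a, hᵢ, bᵢ.  Induction on the order therefore proves all maps of this shape
-- pre-stable at once.  As x ↦ k (x + u) is only defined where x + u ∈ 𝓑P, the induction runs over
-- maps defined on arbitrary down-closed subsets of P.

open import Defs
open import Data.Nat using (ℕ; zero; suc)
open import Data.Bool using (Bool; true; false; not)
open import Data.Vec using (Vec; map; []; _∷_; _++_)
open import Data.Vec.Properties using (map-∘)
open import Data.Vec.Relation.Unary.All using (All; []; _∷_)
import Data.Vec.Relation.Unary.All as All
import Data.Vec.Relation.Unary.All.Properties as All
open import Data.Product using (Σ; _×_; _,_; proj₁; proj₂)
import Data.Product as Product
open import Function using (_∘_)
open import Relation.Binary.PropositionalEquality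
open import Algebra.Bundles using (CommutativeMonoid)
import Algebra.Solver.CommutativeMonoid as CommutativeMonoidSolver

-- The terms in the expansion of Δg (y; h₁ + b₁, …, hₚ + bₚ) are indexed by selections.
data Selection {A : Set} : ∀ {p} → Vec (A × A) p → ∀ {n} → Vec A n → Set where
  []     : Selection [] []
  first  : ∀ {p n h b} {ps : Vec (A × A) p} {W : Vec A n} →
           Selection ps W → Selection ((h , b) ∷ ps) (h ∷ W)
  second : ∀ {p n h b} {ps : Vec (A × A) p} {W : Vec A n} →
           Selection ps W → Selection ((h , b) ∷ ps) (b ∷ W)
  both   : ∀ {p n h b} {ps : Vec (A × A) p} {W : Vec A n} →
           Selection ps W → Selection ((h , b) ∷ ps) (h ∷ b ∷ W)

module _ {A : Set} where

  firsts : ∀ {p} (ps : Vec (A × A) p) → Selection ps (map proj₁ ps)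
  firsts []             = []
  firsts ((h , b) ∷ ps) = first (firsts ps)

  Selection-map : ∀ {B : Set} (ψ : A → B) {p} {ps : Vec (A × A) p} {n} {W : Vec A n} →
                  Selection ps W → Selection (map (Product.map ψ ψ) ps) (map ψ W)
  Selection-map ψ []         = []
  Selection-map ψ (first s)  = first (Selection-map ψ s)
  Selection-map ψ (second s) = second (Selection-map ψ s)
  Selection-map ψ (both s)   = both (Selection-map ψ s)

  Selection-All : ∀ {Pr : A → Set} {p} {ps : Vec (A × A) p} {n} {W : Vec A n} →
                  Selection ps W → All (λ hb → Pr (proj₁ hb) × Pr (proj₂ hb)) ps → All Pr W
  Selection-All []         []                  = []
  Selection-All (first s)  ((prh , prb) ∷ prs) = prh ∷ Selection-All s prs
  Selection-All (second s) ((prh , prb) ∷ prs) = prb ∷ Selection-All s prs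
  Selection-All (both s)   ((prh , prb) ∷ prs) = prh ∷ prb ∷ Selection-All s prs

module _ (ℛ : Reals) where

  module ConeAlgebra (Q : Cone ℛ) where
    open Cone Q

    ⊕-identityʳ : ∀ x → x ⊕ 𝟎 ≡ x
    ⊕-identityʳ x = trans (⊕-comm x 𝟎) (⊕-identityˡ x)

    ⊕-commutativeMonoid : CommutativeMonoid _ _
    ⊕-commutativeMonoid = record
      { Carrier = C ; _≈_ = _≡_ ; _∙_ = _⊕_ ; ε = 𝟎
      ; isCommutativeMonoid = record
        { isMonoid = record
          { isSemigroup = record
            { isMagma = record { isEquivalence = isEquivalence ; ∙-cong = cong₂ _⊕_ }
            ; assoc = ⊕-assoc }
          ; identity = ⊕-identityˡ , ⊕-identityʳ }
        ; comm = ⊕-comm } }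

    open CommutativeMonoidSolver ⊕-commutativeMonoid public
      using (solve; _⊜_) renaming (_⊕_ to _⊞_)

    ∑ : ∀ {n} → Vec C n → C
    ∑ []       = 𝟎
    ∑ (v ∷ vs) = v ⊕ ∑ vs

    ∑-++ : ∀ {m n} (vs : Vec C m) (ws : Vec C n) → ∑ (vs ++ ws) ≡ ∑ vs ⊕ ∑ ws
    ∑-++ []       ws = sym (⊕-identityˡ (∑ ws))
    ∑-++ (v ∷ vs) ws = trans (cong (v ⊕_) (∑-++ vs ws)) (sym (⊕-assoc v (∑ vs) (∑ ws)))

    +Σ≡⊕∑ : ∀ {n} y (vs : Vec C n) → _+Σ_ ℛ Q y vs ≡ y ⊕ ∑ vs
    +Σ≡⊕∑ y []       = sym (⊕-identityʳ y)
    +Σ≡⊕∑ y (v ∷ vs) = trans (+Σ≡⊕∑ (y ⊕ v) vs) (⊕-assoc y v (∑ vs))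

    ⊕-monoʳ-≼ : ∀ z {x x'} → _≼_ ℛ Q x x' → _≼_ ℛ Q (z ⊕ x) (z ⊕ x')
    ⊕-monoʳ-≼ z {x} (e , refl) = e , sym (⊕-assoc z x e)

    ∑-++-monoʳ-≼ : ∀ {m n k} (vs : Vec C m) {ws : Vec C n} {ws' : Vec C k} →
                   _≼_ ℛ Q (∑ ws) (∑ ws') → _≼_ ℛ Q (∑ (vs ++ ws)) (∑ (vs ++ ws'))
    ∑-++-monoʳ-≼ vs {ws} {ws'} (e , eq) = e , (begin
      ∑ (vs ++ ws')       ≡⟨ ∑-++ vs ws' ⟩
      ∑ vs ⊕ ∑ ws'        ≡⟨ cong (∑ vs ⊕_) eq ⟩
      ∑ vs ⊕ (∑ ws ⊕ e)   ≡⟨ ⊕-assoc (∑ vs) (∑ ws) e ⟨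
      (∑ vs ⊕ ∑ ws) ⊕ e   ≡⟨ cong (_⊕ e) (∑-++ vs ws) ⟨
      ∑ (vs ++ ws) ⊕ e    ∎)
      where open ≡-Reasoning

    InBall-≼ : ∀ {x x'} → _≼_ ℛ Q x x' → InBall ℛ Q x' → InBall ℛ Q x
    InBall-≼ {x} (e , refl) = ≤-trans ℛ (norm-mono x e)

    InBall-+Σ-≼ : ∀ y {m n} {ws : Vec C m} {ws' : Vec C n} → _≼_ ℛ Q (∑ ws) (∑ ws') →
                  InBall ℛ Q (_+Σ_ ℛ Q y ws') → InBall ℛ Q (_+Σ_ ℛ Q y ws)
    InBall-+Σ-≼ y {ws = ws} {ws'} ∑ws≼∑ws' =
      InBall-≼ (subst₂ (_≼_ ℛ Q) (sym (+Σ≡⊕∑ y ws)) (sym (+Σ≡⊕∑ y ws'))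
                        (⊕-monoʳ-≼ y ∑ws≼∑ws'))

    pairSums : ∀ {p} → Vec (C × C) p → Vec C p
    pairSums = map (λ hb → proj₁ hb ⊕ proj₂ hb)

    Selection-∑-≼ : ∀ {p} {ps : Vec (C × C) p} {n} {W : Vec C n} →
                    Selection ps W → _≼_ ℛ Q (∑ W) (∑ (pairSums ps))
    Selection-∑-≼ [] = 𝟎 , sym (⊕-identityʳ 𝟎)
    Selection-∑-≼ (first {h = h} {b} {W = W} s) with Selection-∑-≼ s
    ... | e , eq = b ⊕ e , trans (cong ((h ⊕ b) ⊕_) eq)
      (solve 4 (λ h b S e → (h ⊞ b) ⊞ (S ⊞ e) ⊜ (h ⊞ S) ⊞ (b ⊞ e)) refl h b (∑ W) e)
    Selection-∑-≼ (second {h = h} {b} {W = W} s) with Selection-∑-≼ s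
    ... | e , eq = h ⊕ e , trans (cong ((h ⊕ b) ⊕_) eq)
      (solve 4 (λ h b S e → (h ⊞ b) ⊞ (S ⊞ e) ⊜ (b ⊞ S) ⊞ (h ⊞ e)) refl h b (∑ W) e)
    Selection-∑-≼ (both {h = h} {b} {W = W} s) with Selection-∑-≼ s
    ... | e , eq = e , trans (cong ((h ⊕ b) ⊕_) eq)
      (solve 4 (λ h b S e → (h ⊞ b) ⊞ (S ⊞ e) ⊜ (h ⊞ (b ⊞ S)) ⊞ e) refl h b (∑ W) e)

    InBall-selection : ∀ {p} {ps : Vec (C × C) p} {n} {W : Vec C n} → Selection ps W →
                       ∀ y {k} (pre : Vec C k) →
                       InBall ℛ Q (_+Σ_ ℛ Q y (pre ++ pairSums ps)) →
                       InBall ℛ Q (_+Σ_ ℛ Q y (pre ++ W))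
    InBall-selection {ps = ps} {W = W} s y pre =
      InBall-+Σ-≼ y {ws = pre ++ W} {ws' = pre ++ pairSums ps} (∑-++-monoʳ-≼ pre (Selection-∑-≼ s))

  module SelectionSums (R : Cone ℛ) where
    open Cone R
    open ConeAlgebra R using (solve; _⊜_; _⊞_; ⊕-identityʳ)

    Summand : ∀ {A : Set} {p} → Vec (A × A) p → Set
    Summand {A} ps = ∀ {n} (W : Vec A n) → Selection ps W → C

    sumSel : ∀ {A : Set} {p} (ps : Vec (A × A) p) → Summand ps → C
    sumSel []             F = F [] []
    sumSel ((h , b) ∷ ps) F =
      (sumSel ps (λ W s → F (h ∷ W) (first s)) ⊕ sumSel ps (λ W s → F (b ∷ W) (second s)))
        ⊕ sumSel ps (λ W s → F (h ∷ b ∷ W) (both s))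

    sumSelExceptFirsts : ∀ {A : Set} {p} (ps : Vec (A × A) p) → Summand ps → C
    sumSelExceptFirsts []             F = 𝟎
    sumSelExceptFirsts ((h , b) ∷ ps) F =
      (sumSelExceptFirsts ps (λ W s → F (h ∷ W) (first s)) ⊕ sumSel ps (λ W s → F (b ∷ W) (second s)))
        ⊕ sumSel ps (λ W s → F (h ∷ b ∷ W) (both s))

    module _ {A : Set} where

      sumSel-cong : ∀ {p} (ps : Vec (A × A) p) {F G : Summand ps} →
                    (∀ {n} (W : Vec A n) s → F W s ≡ G W s) → sumSel ps F ≡ sumSel ps G
      sumSel-cong []             F≗G = F≗G [] []
      sumSel-cong ((h , b) ∷ ps) F≗G =
        cong₂ _⊕_ (cong₂ _⊕_ (sumSel-cong ps (λ W s → F≗G (h ∷ W) (first s)))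
                             (sumSel-cong ps (λ W s → F≗G (b ∷ W) (second s))))
                  (sumSel-cong ps (λ W s → F≗G (h ∷ b ∷ W) (both s)))

      sumSel-⊕ : ∀ {p} (ps : Vec (A × A) p) (F G : Summand ps) →
                 sumSel ps (λ W s → F W s ⊕ G W s) ≡ sumSel ps F ⊕ sumSel ps G
      sumSel-⊕ []             F G = refl
      sumSel-⊕ ((h , b) ∷ ps) F G =
        trans (cong₂ _⊕_ (cong₂ _⊕_ (sumSel-⊕ ps (λ W s → F (h ∷ W) (first s))
                                                 (λ W s → G (h ∷ W) (first s)))
                                    (sumSel-⊕ ps (λ W s → F (b ∷ W) (second s))
                                                 (λ W s → G (b ∷ W) (second s))))
                         (sumSel-⊕ ps (λ W s → F (h ∷ b ∷ W) (both s))
                                      (λ W s → G (h ∷ b ∷ W) (both s))))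
              (solve 6 (λ a₁ b₁ a₂ b₂ a₃ b₃ → ((a₁ ⊞ b₁) ⊞ (a₂ ⊞ b₂)) ⊞ (a₃ ⊞ b₃)
                                            ⊜ ((a₁ ⊞ a₂) ⊞ a₃) ⊞ ((b₁ ⊞ b₂) ⊞ b₃))
                       refl _ _ _ _ _ _)

      sumSel-split : ∀ {p} (ps : Vec (A × A) p) (F : Summand ps) →
                     sumSel ps F ≡ F (map proj₁ ps) (firsts ps) ⊕ sumSelExceptFirsts ps F
      sumSel-split []             F = sym (⊕-identityʳ _)
      sumSel-split ((h , b) ∷ ps) F =
        trans (cong (λ z → (z ⊕ seconds) ⊕ boths) (sumSel-split ps (λ W s → F (h ∷ W) (first s))))
              (solve 4 (λ a b c d → ((a ⊞ b) ⊞ c) ⊞ d ⊜ a ⊞ ((b ⊞ c) ⊞ d)) refl _ _ _ _)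
        where
          seconds boths : C
          seconds = sumSel ps (λ W s → F (b ∷ W) (second s))
          boths   = sumSel ps (λ W s → F (h ∷ b ∷ W) (both s))

      sumSel-map : ∀ {B : Set} (ψ : A → B) {p} (ps : Vec (A × A) p)
                   (F : Summand (map (Product.map ψ ψ) ps)) →
                   sumSel (map (Product.map ψ ψ) ps) F
                     ≡ sumSel ps (λ W s → F (map ψ W) (Selection-map ψ s))
      sumSel-map ψ []             F = refl
      sumSel-map ψ ((h , b) ∷ ps) F =
        cong₂ _⊕_ (cong₂ _⊕_ (sumSel-map ψ ps (λ W s → F (ψ h ∷ W) (first s)))
                             (sumSel-map ψ ps (λ W s → F (ψ b ∷ W) (second s))))
                  (sumSel-map ψ ps (λ W s → F (ψ h ∷ ψ b ∷ W) (both s)))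

  module DifferenceCalculus (Q R : Cone ℛ) (g : Ball ℛ Q → Cone.C R) (pg : PreStable ℛ Q R g) where
    open Cone Q using () renaming (C to CQ; _⊕_ to _+Q_; ⊕-assoc to +Q-assoc)
    open Cone R using () renaming (C to CR; _⊕_ to _+R_; ⊕-assoc to +R-assoc)
    open ConeAlgebra Q using (pairSums; InBall-selection)
    open ConeAlgebra R using (solve; _⊜_; _⊞_)
    open SelectionSums R using (sumSel; sumSel-cong; sumSel-⊕)

    _+ΣQ_ : ∀ {n} → CQ → Vec CQ n → CQ
    _+ΣQ_ = _+Σ_ ℛ Q

    InBallQ : CQ → Set
    InBallQ = InBall ℛ Q

    Δg : ∀ {n} y (vs : Vec CQ n) → .(InBallQ (y +ΣQ vs)) → CR
    Δg = Δ ℛ g pg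

    Δ±g : Bool → ∀ {n} y (vs : Vec CQ n) → .(InBallQ (y +ΣQ vs)) → CR
    Δ±g = Δ± ℛ {Q} {R} g

    Δg-cong : ∀ {n} {y y'} {vs vs' : Vec CQ n} → y ≡ y' → vs ≡ vs' →
              .(m : InBallQ (y +ΣQ vs)) .(m' : InBallQ (y' +ΣQ vs')) → Δg y vs m ≡ Δg y' vs' m'
    Δg-cong refl refl m m' = refl

    Δ⁺≡Δ⁻⊕Δ : ∀ {n} y (vs : Vec CQ n) .m → Δ±g true y vs m ≡ Δ±g false y vs m +R Δg y vs m
    Δ⁺≡Δ⁻⊕Δ y []       m = sym (Cone.⊕-identityˡ R _)
    Δ⁺≡Δ⁻⊕Δ y (v ∷ vs) m = proj₂ (pg y (v ∷ vs) m)

    Δg-cocycle : ∀ {n} y v (vs : Vec CQ n) .(m : InBallQ (y +ΣQ (v ∷ vs))) .(m' : InBallQ (y +ΣQ vs)) →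
                 Δg (y +Q v) vs m ≡ Δg y vs m' +R Δg y (v ∷ vs) m
    Δg-cocycle y v vs m m' = Cone.cancel R (a +R a') _ _ (begin
        (a +R a') +R Δg (y +Q v) vs m
          ≡⟨ +R-assoc a a' _ ⟩
        a +R (a' +R Δg (y +Q v) vs m)
          ≡⟨ cong (a +R_) (Δ⁺≡Δ⁻⊕Δ (y +Q v) vs m) ⟨
        Δ±g true y (v ∷ vs) m
          ≡⟨ Δ⁺≡Δ⁻⊕Δ y (v ∷ vs) m ⟩
        Δ±g false y (v ∷ vs) m +R τ
          ≡⟨ cong (λ z → (z +R a') +R τ) (Δ⁺≡Δ⁻⊕Δ y vs m') ⟩
        ((a +R t) +R a') +R τ
          ≡⟨ solve 4 (λ a t a' τ → ((a ⊞ t) ⊞ a') ⊞ τ ⊜ (a ⊞ a') ⊞ (t ⊞ τ)) refl a t a' τ ⟩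
        (a +R a') +R (t +R τ) ∎)
      where
        open ≡-Reasoning
        a a' t τ : CR
        a  = Δ±g false y vs m'
        a' = Δ±g false (y +Q v) vs m
        t  = Δg y vs m'
        τ  = Δg y (v ∷ vs) m

    InBall-unpair : ∀ {n} y h b (X : Vec CQ n) →
                    InBallQ (y +ΣQ ((h +Q b) ∷ X)) → InBallQ (y +ΣQ (h ∷ b ∷ X))
    InBall-unpair y h b X = subst (λ z → InBallQ (z +ΣQ X)) (sym (+Q-assoc y h b))

    Δg-additive : ∀ {n} y h b (X : Vec CQ n) .(m : InBallQ (y +ΣQ ((h +Q b) ∷ X)))
                  .(mₕ : InBallQ (y +ΣQ (h ∷ X))) .(m_b : InBallQ (y +ΣQ (b ∷ X)))
                  .(mₕ_b : InBallQ (y +ΣQ (h ∷ b ∷ X))) →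
                  Δg y ((h +Q b) ∷ X) m
                    ≡ (Δg y (h ∷ X) mₕ +R Δg y (b ∷ X) m_b) +R Δg y (h ∷ b ∷ X) mₕ_b
    Δg-additive y h b X m mₕ m_b mₕ_b =
      trans (Cone.cancel R t₀ _ _ (begin
          t₀ +R Δg y ((h +Q b) ∷ X) m
            ≡⟨ Δg-cocycle y (h +Q b) X m (excl ℛ Q y (h +Q b) X m) ⟨
          Δg (y +Q (h +Q b)) X m
            ≡⟨ Δg-cong {vs = X} (sym (+Q-assoc y h b)) refl m mₕ_b ⟩
          Δg ((y +Q h) +Q b) X mₕ_b
            ≡⟨ Δg-cocycle (y +Q h) b X mₕ_b mₕ ⟩
          Δg (y +Q h) X mₕ +R Δg (y +Q h) (b ∷ X) mₕ_b
            ≡⟨ cong₂ _+R_ (Δg-cocycle y h X mₕ (excl ℛ Q y (h +Q b) X m))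
                          (Δg-cocycle y h (b ∷ X) mₕ_b m_b) ⟩
          (t₀ +R tₕ) +R (t_b +R tₕ_b)
            ≡⟨ +R-assoc t₀ tₕ _ ⟩
          t₀ +R (tₕ +R (t_b +R tₕ_b)) ∎))
        (sym (+R-assoc tₕ t_b tₕ_b))
      where
        open ≡-Reasoning
        t₀ tₕ t_b tₕ_b : CR
        t₀   = Δg y X (excl ℛ Q y (h +Q b) X m)
        tₕ   = Δg y (h ∷ X) mₕ
        t_b  = Δg y (b ∷ X) m_b
        tₕ_b = Δg y (h ∷ b ∷ X) mₕ_b

    Δg-expand : ∀ {p} (ps : Vec (CQ × CQ) p) y {k} (pre : Vec CQ k)
                .(m : InBallQ (y +ΣQ (pre ++ pairSums ps))) →
                Δg y (pre ++ pairSums ps) m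
                  ≡ sumSel ps (λ W s → Δg y (pre ++ W) (InBall-selection s y pre m))
    Δg-expand [] y pre m = refl
    Δg-expand {suc p} ((h , b) ∷ ps) y [] m =
      trans (Δg-additive y h b Z m (keepFirst m) (keepSecond m) (unpair m))
            (cong₂ _+R_ (cong₂ _+R_ (Δg-expand ps y (h ∷ []) (keepFirst m))
                                    (Δg-expand ps y (b ∷ []) (keepSecond m)))
                        (Δg-expand ps y (h ∷ b ∷ []) (unpair m)))
      where
        Z : Vec CQ p
        Z = pairSums ps
        unpair : InBallQ (y +ΣQ ((h +Q b) ∷ Z)) → InBallQ (y +ΣQ (h ∷ b ∷ Z))
        unpair = InBall-unpair y h b Z
        keepFirst : InBallQ (y +ΣQ ((h +Q b) ∷ Z)) → InBallQ (y +ΣQ (h ∷ Z))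
        keepFirst = excl ℛ Q (y +Q h) b Z ∘ unpair
        keepSecond : InBallQ (y +ΣQ ((h +Q b) ∷ Z)) → InBallQ (y +ΣQ (b ∷ Z))
        keepSecond = excl ℛ Q y h (b ∷ Z) ∘ unpair
    -- The cocycle identity at y and at y + w reduces this case to the expansions at prefix pre.
    Δg-expand {p} ps@(_ ∷ _) y (w ∷ pre) m = Cone.cancel R (sumSel ps F) _ _ (begin
        sumSel ps F +R Δg y (w ∷ pre ++ Z) m
          ≡⟨ cong (_+R Δg y (w ∷ pre ++ Z) m) (Δg-expand ps y pre (excl ℛ Q y w (pre ++ Z) m)) ⟨
        Δg y (pre ++ Z) (excl ℛ Q y w (pre ++ Z) m) +R Δg y (w ∷ pre ++ Z) m
          ≡⟨ Δg-cocycle y w (pre ++ Z) m (excl ℛ Q y w (pre ++ Z) m) ⟨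
        Δg (y +Q w) (pre ++ Z) m
          ≡⟨ Δg-expand ps (y +Q w) pre m ⟩
        sumSel ps (λ W s → Δg (y +Q w) (pre ++ W) (InBall-selection s (y +Q w) pre m))
          ≡⟨ sumSel-cong ps (λ W s → Δg-cocycle y w (pre ++ W) (InBall-selection s y (w ∷ pre) m)
                                       (InBall-selection s y pre (excl ℛ Q y w (pre ++ Z) m))) ⟩
        sumSel ps (λ W s → F W s +R G W s)
          ≡⟨ sumSel-⊕ ps F G ⟩
        sumSel ps F +R sumSel ps G ∎)
      where
        open ≡-Reasoning
        Z : Vec CQ p
        Z = pairSums ps
        F G : ∀ {n} (W : Vec CQ n) → Selection ps W → CR
        F W s = Δg y (pre ++ W) (InBall-selection s y pre (excl ℛ Q y w (pre ++ Z) m))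
        G W s = Δg y (w ∷ pre ++ W) (InBall-selection s y (w ∷ pre) m)

  record DownSet (P : Cone ℛ) : Set₁ where
    field
      member      : Cone.C P → Set
      down-closed : ∀ x y → member (Cone._⊕_ P x y) → member x

  module DownSets (P : Cone ℛ) where
    open Cone P using () renaming (C to CP; _⊕_ to _+P_)
    open DownSet

    _+ΣP_ : ∀ {n} → CP → Vec CP n → CP
    _+ΣP_ = _+Σ_ ℛ P

    unitBall : DownSet P
    unitBall = record
      { member      = InBall ℛ P
      ; down-closed = λ x y → ≤-trans ℛ (Cone.norm-mono P x y) }

    shiftedBy : DownSet P → CP → DownSet P
    shiftedBy D u = record
      { member      = λ x → member D (x +P u)
      ; down-closed = λ x y d → down-closed D (x +P u) y (subst (member D) (swap ℛ P x y u) d) }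

    member-excl : ∀ (D : DownSet P) {n} y v (vs : Vec CP n) →
                  member D (y +ΣP (v ∷ vs)) → member D (y +ΣP vs)
    member-excl D y v vs d = down-closed D (y +ΣP vs) v (subst (member D) (shift ℛ P y v vs) d)

    toShifted : ∀ (D : DownSet P) u {n} y (vs : Vec CP n) →
                member D (y +ΣP (u ∷ vs)) → member (shiftedBy D u) (y +ΣP vs)
    toShifted D u y vs = subst (member D) (shift ℛ P y u vs)

    fromShifted : ∀ (D : DownSet P) u {n} y (vs : Vec CP n) →
                  member (shiftedBy D u) (y +ΣP vs) → member D (y +ΣP (u ∷ vs))
    fromShifted D u y vs = subst (member D) (sym (shift ℛ P y u vs))

    MapOn : DownSet P → Cone ℛ → Set
    MapOn D R = (x : CP) → .(member D x) → Cone.C R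

    module Differences (R : Cone ℛ) where
      open Cone R using () renaming (C to CR; _⊕_ to _+R_; 𝟎 to 0R; ⊕-identityˡ to +R-identityˡ)
      open ConeAlgebra R using (solve; _⊜_; _⊞_) renaming (⊕-identityʳ to +R-identityʳ)
      open SelectionSums R using (sumSel; sumSelExceptFirsts)

      Δ±On : ∀ (D : DownSet P) → MapOn D R → Bool →
             ∀ {n} y (vs : Vec CP n) → .(member D (y +ΣP vs)) → CR
      Δ±On D F b     y (v ∷ vs) m =
        Δ±On D F (not b) y vs (member-excl D y v vs m) +R Δ±On D F b (y +P v) vs m
      Δ±On D F true  y []       m = F y m
      Δ±On D F false y []       m = 0R

      PreStableOfOrder : ∀ (D : DownSet P) → MapOn D R → ℕ → Set
      PreStableOfOrder D F n =
        ∀ y (vs : Vec CP n) .m → _≼_ ℛ R (Δ±On D F false y vs m) (Δ±On D F true y vs m)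

      PreStableOn : ∀ (D : DownSet P) → MapOn D R → Set
      PreStableOn D F = ∀ n → PreStableOfOrder D F n

      Δ±On-cong : ∀ (D : DownSet P) {F G : MapOn D R} → (∀ x .d → F x d ≡ G x d) →
                  ∀ b {n} y (vs : Vec CP n) .m → Δ±On D F b y vs m ≡ Δ±On D G b y vs m
      Δ±On-cong D F≗G true  y []       m = F≗G y m
      Δ±On-cong D F≗G false y []       m = refl
      Δ±On-cong D F≗G b     y (v ∷ vs) m =
        cong₂ _+R_ (Δ±On-cong D F≗G (not b) y vs (member-excl D y v vs m))
                   (Δ±On-cong D F≗G b (y +P v) vs m)

      Δ±On-cong-base : ∀ (D : DownSet P) (F : MapOn D R) b {n} {y y'} (vs : Vec CP n) → y ≡ y' →
                       .(m : member D (y +ΣP vs)) .(m' : member D (y' +ΣP vs)) →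
                       Δ±On D F b y vs m ≡ Δ±On D F b y' vs m'
      Δ±On-cong-base D F b vs refl m m' = refl

      Δ±On-⊕ : ∀ (D : DownSet P) (F G : MapOn D R) b {n} y (vs : Vec CP n) .m →
               Δ±On D (λ x d → F x d +R G x d) b y vs m ≡ Δ±On D F b y vs m +R Δ±On D G b y vs m
      Δ±On-⊕ D F G true  y []       m = refl
      Δ±On-⊕ D F G false y []       m = sym (+R-identityʳ 0R)
      Δ±On-⊕ D F G b     y (v ∷ vs) m =
        trans (cong₂ _+R_ (Δ±On-⊕ D F G (not b) y vs (member-excl D y v vs m))
                          (Δ±On-⊕ D F G b (y +P v) vs m))
              (solve 4 (λ a b c d → (a ⊞ b) ⊞ (c ⊞ d) ⊜ (a ⊞ c) ⊞ (b ⊞ d)) refl _ _ _ _)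

      Δ±On-𝟎 : ∀ (D : DownSet P) b {n} y (vs : Vec CP n) .m → Δ±On D (λ x d → 0R) b y vs m ≡ 0R
      Δ±On-𝟎 D true  y []       m = refl
      Δ±On-𝟎 D false y []       m = refl
      Δ±On-𝟎 D b     y (v ∷ vs) m =
        trans (cong₂ _+R_ (Δ±On-𝟎 D (not b) y vs (member-excl D y v vs m)) (Δ±On-𝟎 D b (y +P v) vs m))
              (+R-identityˡ 0R)

      Δ±On-translate : ∀ (D : DownSet P) u (F : MapOn D R) b {n} y (vs : Vec CP n)
                       .(m : member (shiftedBy D u) (y +ΣP vs)) →
                       Δ±On (shiftedBy D u) (λ x d → F (x +P u) d) b y vs m
                         ≡ Δ±On D F b (y +P u) vs (fromShifted D u y vs m)
      Δ±On-translate D u F true  y []       m = refl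
      Δ±On-translate D u F false y []       m = refl
      Δ±On-translate D u F b     y (v ∷ vs) m =
        cong₂ _+R_ (Δ±On-translate D u F (not b) y vs (member-excl (shiftedBy D u) y v vs m))
                   (trans (Δ±On-translate D u F b (y +P v) vs m)
                          (Δ±On-cong-base D F b vs (swap ℛ P y v u)
                             (fromShifted D u (y +P v) vs m) (fromShifted D u y (v ∷ vs) m)))

      restrict : ∀ (D : DownSet P) (F : MapOn D R) u → MapOn (shiftedBy D u) R
      restrict D F u x d = F x (down-closed D x u d)

      Δ±On-restrict : ∀ (D : DownSet P) u (F : MapOn D R) b {n} y (vs : Vec CP n)
                      .(m : member (shiftedBy D u) (y +ΣP vs)) →
                      Δ±On (shiftedBy D u) (restrict D F u) b y vs m
                        ≡ Δ±On D F b y vs (down-closed D (y +ΣP vs) u m)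
      Δ±On-restrict D u F true  y []       m = refl
      Δ±On-restrict D u F false y []       m = refl
      Δ±On-restrict D u F b     y (v ∷ vs) m =
        cong₂ _+R_ (Δ±On-restrict D u F (not b) y vs (member-excl (shiftedBy D u) y v vs m))
                   (Δ±On-restrict D u F b (y +P v) vs m)

      PreStableOfOrder-zero : ∀ (D : DownSet P) (F : MapOn D R) → PreStableOfOrder D F 0
      PreStableOfOrder-zero D F y [] m = F y m , sym (+R-identityˡ (F y m))

      PreStableOfOrder-cong : ∀ (D : DownSet P) {F G : MapOn D R} → (∀ x .d → F x d ≡ G x d) →
                              ∀ {n} → PreStableOfOrder D F n → PreStableOfOrder D G n
      PreStableOfOrder-cong D F≗G psF y vs m with psF y vs m
      ... | r , eqF = r , trans (sym (Δ±On-cong D F≗G true y vs m))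
                                (trans eqF (cong (_+R r) (Δ±On-cong D F≗G false y vs m)))

      PreStableOfOrder-⊕ : ∀ (D : DownSet P) {F G : MapOn D R} {n} →
                           PreStableOfOrder D F n → PreStableOfOrder D G n →
                           PreStableOfOrder D (λ x d → F x d +R G x d) n
      PreStableOfOrder-⊕ D {F} {G} psF psG y vs m with psF y vs m | psG y vs m
      ... | r , eqF | s , eqG = r +R s , (begin
        Δ±On D (λ x d → F x d +R G x d) true y vs m
          ≡⟨ Δ±On-⊕ D F G true y vs m ⟩
        Δ±On D F true y vs m +R Δ±On D G true y vs m
          ≡⟨ cong₂ _+R_ eqF eqG ⟩
        (F⁻ +R r) +R (G⁻ +R s)
          ≡⟨ solve 4 (λ a r b s → (a ⊞ r) ⊞ (b ⊞ s) ⊜ (a ⊞ b) ⊞ (r ⊞ s)) refl F⁻ r G⁻ s ⟩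
        (F⁻ +R G⁻) +R (r +R s)
          ≡⟨ cong (_+R (r +R s)) (Δ±On-⊕ D F G false y vs m) ⟨
        Δ±On D (λ x d → F x d +R G x d) false y vs m +R (r +R s) ∎)
        where
          open ≡-Reasoning
          F⁻ G⁻ : CR
          F⁻ = Δ±On D F false y vs m
          G⁻ = Δ±On D G false y vs m

      PreStableOfOrder-𝟎 : ∀ (D : DownSet P) {n} → PreStableOfOrder D (λ x d → 0R) n
      PreStableOfOrder-𝟎 D y vs m =
        0R , trans (Δ±On-𝟎 D true y vs m)
                   (trans (sym (+R-identityʳ 0R)) (cong (_+R 0R) (sym (Δ±On-𝟎 D false y vs m))))

      module _ (D : DownSet P) {n : ℕ} {A : Set} where

        PreStableOfOrder-sumSel :
          ∀ {p} (ps : Vec (A × A) p) (F : ∀ {k} (W : Vec A k) → Selection ps W → MapOn D R) →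
          (∀ {k} (W : Vec A k) s → PreStableOfOrder D (F W s) n) →
          PreStableOfOrder D (λ x d → sumSel ps (λ W s → F W s x d)) n
        PreStableOfOrder-sumSel []             F psF = psF [] []
        PreStableOfOrder-sumSel ((h , b) ∷ ps) F psF =
          PreStableOfOrder-⊕ D
            (PreStableOfOrder-⊕ D
              (PreStableOfOrder-sumSel ps (λ W s → F (h ∷ W) (first s)) (λ W s → psF (h ∷ W) (first s)))
              (PreStableOfOrder-sumSel ps (λ W s → F (b ∷ W) (second s)) (λ W s → psF (b ∷ W) (second s))))
            (PreStableOfOrder-sumSel ps (λ W s → F (h ∷ b ∷ W) (both s)) (λ W s → psF (h ∷ b ∷ W) (both s)))

        PreStableOfOrder-sumSelExceptFirsts :
          ∀ {p} (ps : Vec (A × A) p) (F : ∀ {k} (W : Vec A k) → Selection ps W → MapOn D R) →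
          (∀ {k} (W : Vec A k) s → PreStableOfOrder D (F W s) n) →
          PreStableOfOrder D (λ x d → sumSelExceptFirsts ps (λ W s → F W s x d)) n
        PreStableOfOrder-sumSelExceptFirsts []             F psF = PreStableOfOrder-𝟎 D
        PreStableOfOrder-sumSelExceptFirsts ((h , b) ∷ ps) F psF =
          PreStableOfOrder-⊕ D
            (PreStableOfOrder-⊕ D
              (PreStableOfOrder-sumSelExceptFirsts ps (λ W s → F (h ∷ W) (first s))
                                                      (λ W s → psF (h ∷ W) (first s)))
              (PreStableOfOrder-sumSel ps (λ W s → F (b ∷ W) (second s)) (λ W s → psF (b ∷ W) (second s))))
            (PreStableOfOrder-sumSel ps (λ W s → F (h ∷ b ∷ W) (both s)) (λ W s → psF (h ∷ b ∷ W) (both s)))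

      IsIncrement : ∀ (D : DownSet P) (F : MapOn D R) u → MapOn (shiftedBy D u) R → Set
      IsIncrement D F u K = ∀ x .d → F (x +P u) d ≡ restrict D F u x d +R K x d

      Δ±On-increment : ∀ (D : DownSet P) u (F : MapOn D R) (K : MapOn (shiftedBy D u) R) →
                       IsIncrement D F u K →
                       ∀ b {n} y (ws : Vec CP n) .(m : member (shiftedBy D u) (y +ΣP ws)) →
                       Δ±On D F b (y +P u) ws (fromShifted D u y ws m)
                         ≡ Δ±On D F b y ws (down-closed D (y +ΣP ws) u m) +R Δ±On (shiftedBy D u) K b y ws m
      Δ±On-increment D u F K isIncrement b y ws m = begin
        Δ±On D F b (y +P u) ws (fromShifted D u y ws m)
          ≡⟨ Δ±On-translate D u F b y ws m ⟨
        Δ±On D' (λ x d → F (x +P u) d) b y ws m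
          ≡⟨ Δ±On-cong D' isIncrement b y ws m ⟩
        Δ±On D' (λ x d → restrict D F u x d +R K x d) b y ws m
          ≡⟨ Δ±On-⊕ D' (restrict D F u) K b y ws m ⟩
        Δ±On D' (restrict D F u) b y ws m +R Δ±On D' K b y ws m
          ≡⟨ cong (_+R Δ±On D' K b y ws m) (Δ±On-restrict D u F b y ws m) ⟩
        Δ±On D F b y ws (down-closed D (y +ΣP ws) u m) +R Δ±On D' K b y ws m ∎
        where
          open ≡-Reasoning
          D' : DownSet P
          D' = shiftedBy D u

      PreStableOfOrder-suc :
        ∀ (D : DownSet P) (F : MapOn D R) n →
        (∀ u → Σ (MapOn (shiftedBy D u) R) λ K →
                 IsIncrement D F u K × PreStableOfOrder (shiftedBy D u) K n) →
        PreStableOfOrder D F (suc n)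
      PreStableOfOrder-suc D F n increments y (u ∷ ws) m with increments u
      ... | K , isIncrement , psK with psK y ws (toShifted D u y ws m)
      ... | r , eqK = r , (begin
          F⁻ +R Δ±On D F true (y +P u) ws m
            ≡⟨ cong (F⁻ +R_) (Δ±On-increment D u F K isIncrement true y ws (toShifted D u y ws m)) ⟩
          F⁻ +R (F⁺ +R K⁺)
            ≡⟨ cong (λ z → F⁻ +R (F⁺ +R z)) eqK ⟩
          F⁻ +R (F⁺ +R (K⁻ +R r))
            ≡⟨ solve 4 (λ a b c r → a ⊞ (b ⊞ (c ⊞ r)) ⊜ (b ⊞ (a ⊞ c)) ⊞ r) refl F⁻ F⁺ K⁻ r ⟩
          (F⁺ +R (F⁻ +R K⁻)) +R r
            ≡⟨ cong (λ z → (F⁺ +R z) +R r)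
                    (Δ±On-increment D u F K isIncrement false y ws (toShifted D u y ws m)) ⟨
          (F⁺ +R Δ±On D F false (y +P u) ws m) +R r ∎)
        where
          open ≡-Reasoning
          F⁻ F⁺ K⁻ K⁺ : CR
          F⁻ = Δ±On D F false y ws (member-excl D y u ws m)
          F⁺ = Δ±On D F true y ws (member-excl D y u ws m)
          K⁻ = Δ±On (shiftedBy D u) K false y ws (toShifted D u y ws m)
          K⁺ = Δ±On (shiftedBy D u) K true y ws (toShifted D u y ws m)

      -- Order-1 pre-stability is F x ⊕ 𝟎 ≼ 𝟎 ⊕ F (x ⊕ u).
      increment : ∀ (D : DownSet P) (F : MapOn D R) → PreStableOn D F → ∀ u → MapOn (shiftedBy D u) R
      increment D F psF u x d = proj₁ (psF 1 x (u ∷ []) d)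

      increment-isIncrement : ∀ (D : DownSet P) (F : MapOn D R) (psF : PreStableOn D F) u →
                              IsIncrement D F u (increment D F psF u)
      increment-isIncrement D F psF u x d =
        trans (sym (+R-identityˡ _))
              (trans (proj₂ (psF 1 x (u ∷ []) d)) (cong (_+R increment D F psF u x d) (+R-identityʳ _)))

      increment-preStable : ∀ (D : DownSet P) (F : MapOn D R) (psF : PreStableOn D F) u →
                            PreStableOn (shiftedBy D u) (increment D F psF u)
      increment-preStable D F psF u n y ws m with psF (suc n) y (u ∷ ws) (fromShifted D u y ws m)
      ... | r , eqF = r , Cone.cancel R (F⁻ +R F⁺) _ _ (begin
          (F⁻ +R F⁺) +R a⁺
            ≡⟨ Cone.⊕-assoc R F⁻ F⁺ a⁺ ⟩
          F⁻ +R (F⁺ +R a⁺)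
            ≡⟨ cong (F⁻ +R_) (Δ±On-increment D u F a (increment-isIncrement D F psF u) true y ws m) ⟨
          Δ±On D F true y (u ∷ ws) (fromShifted D u y ws m)
            ≡⟨ eqF ⟩
          Δ±On D F false y (u ∷ ws) (fromShifted D u y ws m) +R r
            ≡⟨ cong (λ z → (F⁺ +R z) +R r)
                    (Δ±On-increment D u F a (increment-isIncrement D F psF u) false y ws m) ⟩
          (F⁺ +R (F⁻ +R a⁻)) +R r
            ≡⟨ solve 4 (λ a b c r → (b ⊞ (a ⊞ c)) ⊞ r ⊜ (a ⊞ b) ⊞ (c ⊞ r)) refl F⁻ F⁺ a⁻ r ⟩
          (F⁻ +R F⁺) +R (a⁻ +R r) ∎)
        where
          open ≡-Reasoning
          a : MapOn (shiftedBy D u) R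
          a  = increment D F psF u
          F⁻ F⁺ a⁻ a⁺ : CR
          F⁻ = Δ±On D F false y ws (down-closed D (y +ΣP ws) u m)
          F⁺ = Δ±On D F true y ws (down-closed D (y +ΣP ws) u m)
          a⁻ = Δ±On (shiftedBy D u) a false y ws m
          a⁺ = Δ±On (shiftedBy D u) a true y ws m

      restrict-preStable : ∀ (D : DownSet P) (F : MapOn D R) → PreStableOn D F → ∀ u →
                           PreStableOn (shiftedBy D u) (restrict D F u)
      restrict-preStable D F psF u n y ws m with psF n y ws (down-closed D (y +ΣP ws) u m)
      ... | r , eqF = r , trans (Δ±On-restrict D u F true y ws m)
                                (trans eqF (cong (_+R r) (sym (Δ±On-restrict D u F false y ws m))))

      onUnitBall : (Ball ℛ P → CR) → MapOn unitBall R
      onUnitBall F x d = F (ball x d)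

      Δ±On-unitBall : ∀ (F : Ball ℛ P → CR) b {n} y (vs : Vec CP n) .m →
                      Δ±On unitBall (onUnitBall F) b y vs m ≡ Δ± ℛ {P} {R} F b y vs m
      Δ±On-unitBall F true  y []       m = refl
      Δ±On-unitBall F false y []       m = refl
      Δ±On-unitBall F true  y (v ∷ vs) m =
        cong₂ _+R_ (Δ±On-unitBall F false y vs (excl ℛ P y v vs m)) (Δ±On-unitBall F true (y +P v) vs m)
      Δ±On-unitBall F false y (v ∷ vs) m =
        cong₂ _+R_ (Δ±On-unitBall F true y vs (excl ℛ P y v vs m)) (Δ±On-unitBall F false (y +P v) vs m)

      PreStable-onUnitBall : ∀ {F : Ball ℛ P → CR} → PreStable ℛ P R F →
                             PreStableOn unitBall (onUnitBall F)
      PreStable-onUnitBall {F} psF zero    = PreStableOfOrder-zero unitBall (onUnitBall F)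
      PreStable-onUnitBall {F} psF (suc n) y vs m with psF y vs m
      ... | r , eqF = r , trans (Δ±On-unitBall F true y vs m)
                                (trans eqF (cong (_+R r) (sym (Δ±On-unitBall F false y vs m))))

      PreStable-fromUnitBall : ∀ {F : Ball ℛ P → CR} → PreStableOn unitBall (onUnitBall F) →
                               PreStable ℛ P R F
      PreStable-fromUnitBall {F} psF {n} y vs m with psF (suc n) y vs m
      ... | r , eqF = r , trans (sym (Δ±On-unitBall F true y vs m))
                                (trans eqF (cong (_+R r) (Δ±On-unitBall F false y vs m)))

  module Composition (P Q R : Cone ℛ) (g : Ball ℛ Q → Cone.C R) (pg : PreStable ℛ Q R g) where
    open Cone P using () renaming (C to CP; _⊕_ to _+P_)
    open Cone Q using () renaming (C to CQ; _⊕_ to _+Q_)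
    open Cone R using () renaming (C to CR; _⊕_ to _+R_)
    open DownSet
    open DownSets P
    open DifferenceCalculus Q R g pg
    open ConeAlgebra Q using (pairSums; InBall-selection)
    open SelectionSums R using (sumSel; sumSelExceptFirsts; sumSel-split; sumSel-map)
    module DQ = Differences Q
    module DR = Differences R

    LandsInBall : ∀ (D : DownSet P) {p} → MapOn D Q → Vec (MapOn D Q) p → Set
    LandsInBall D f hs = ∀ x .(d : member D x) → InBallQ (f x d +ΣQ map (λ h → h x d) hs)

    composite : ∀ (D : DownSet P) {p} (f : MapOn D Q) (hs : Vec (MapOn D Q) p) →
                LandsInBall D f hs → MapOn D R
    composite D f hs mem x d = Δg (f x d) (map (λ h → h x d) hs) (mem x d)

    evalAt : ∀ (D : DownSet P) x → .(member D x) → MapOn D Q → CQ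
    evalAt D x d h = h x d

    evalPairsAt : ∀ (D : DownSet P) x → .(member D x) → ∀ {p} →
                  Vec (MapOn D Q × MapOn D Q) p → Vec (CQ × CQ) p
    evalPairsAt D x d = map (Product.map (evalAt D x d) (evalAt D x d))

    incrementPairs : ∀ (D : DownSet P) {p} (hs : Vec (MapOn D Q) p) → All (DQ.PreStableOn D) hs → ∀ u →
                     Vec (MapOn (shiftedBy D u) Q × MapOn (shiftedBy D u) Q) p
    incrementPairs D []       []           u = []
    incrementPairs D (h ∷ hs) (psh ∷ pshs) u =
      (DQ.restrict D h u , DQ.increment D h psh u) ∷ incrementPairs D hs pshs u

    incrementPairs-preStable :
      ∀ (D : DownSet P) {p} (hs : Vec (MapOn D Q) p) (pshs : All (DQ.PreStableOn D) hs) u →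
      All (λ hb → DQ.PreStableOn (shiftedBy D u) (proj₁ hb) × DQ.PreStableOn (shiftedBy D u) (proj₂ hb))
          (incrementPairs D hs pshs u)
    incrementPairs-preStable D []       []           u = []
    incrementPairs-preStable D (h ∷ hs) (psh ∷ pshs) u =
      (DQ.restrict-preStable D h psh u , DQ.increment-preStable D h psh u)
        ∷ incrementPairs-preStable D hs pshs u

    map-shifted≡pairSums :
      ∀ (D : DownSet P) {p} (hs : Vec (MapOn D Q) p) (pshs : All (DQ.PreStableOn D) hs) u x
      .(d : member D (x +P u)) →
      map (λ h → h (x +P u) d) hs ≡ pairSums (evalPairsAt (shiftedBy D u) x d (incrementPairs D hs pshs u))
    map-shifted≡pairSums D []       []           u x d = refl
    map-shifted≡pairSums D (h ∷ hs) (psh ∷ pshs) u x d =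
      cong₂ _∷_ (DQ.increment-isIncrement D h psh u x d) (map-shifted≡pairSums D hs pshs u x d)

    map-firsts-incrementPairs :
      ∀ (D : DownSet P) {p} (hs : Vec (MapOn D Q) p) (pshs : All (DQ.PreStableOn D) hs) u x
      .(d : member D (x +P u)) →
      map (evalAt (shiftedBy D u) x d) (map proj₁ (incrementPairs D hs pshs u))
        ≡ map (λ h → h x (down-closed D x u d)) hs
    map-firsts-incrementPairs D []       []           u x d = refl
    map-firsts-incrementPairs D (h ∷ hs) (psh ∷ pshs) u x d =
      cong (_ ∷_) (map-firsts-incrementPairs D hs pshs u x d)

    module CompositeIncrement (D : DownSet P) {p} (f : MapOn D Q) (hs : Vec (MapOn D Q) p)
                              (psf : DQ.PreStableOn D f) (pshs : All (DQ.PreStableOn D) hs)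
                              (mem : LandsInBall D f hs) (u : CP) where
      D' : DownSet P
      D' = shiftedBy D u

      f' a : MapOn D' Q
      f' = DQ.restrict D f u
      a  = DQ.increment D f psf u

      pairs : Vec (MapOn D' Q × MapOn D' Q) p
      pairs = incrementPairs D hs pshs u

      mem-shifted : ∀ x .(d : member D' x) →
                    InBallQ ((f' x d +Q a x d) +ΣQ pairSums (evalPairsAt D' x d pairs))
      mem-shifted x d = subst InBallQ (cong₂ _+ΣQ_ (DQ.increment-isIncrement D f psf u x d)
                                                  (map-shifted≡pairSums D hs pshs u x d))
                              (mem (x +P u) d)

      mem-selection : ∀ {k} {W : Vec (MapOn D' Q) k} → Selection pairs W → LandsInBall D' f' W
      mem-selection s x d =
        InBall-selection (Selection-map (evalAt D' x d) s) (f' x d) []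
          (excl ℛ Q (f' x d) (a x d) (pairSums (evalPairsAt D' x d pairs)) (mem-shifted x d))

      mem-a∷selection : ∀ {k} {W : Vec (MapOn D' Q) k} → Selection pairs W → LandsInBall D' f' (a ∷ W)
      mem-a∷selection s x d =
        InBall-selection (Selection-map (evalAt D' x d) s) (f' x d) (a x d ∷ []) (mem-shifted x d)

      K : MapOn D' R
      K x d = sumSelExceptFirsts pairs (λ W s → composite D' f' W (mem-selection s) x d)
                +R sumSel pairs (λ W s → composite D' f' (a ∷ W) (mem-a∷selection s) x d)

      K-isIncrement : DR.IsIncrement D (composite D f hs mem) u K
      K-isIncrement x d = begin
        composite D f hs mem (x +P u) d
          ≡⟨ Δg-cong (DQ.increment-isIncrement D f psf u x d) (map-shifted≡pairSums D hs pshs u x d)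
                     (mem (x +P u) d) (mem-shifted x d) ⟩
        Δg (fx +Q ax) (pairSums ps) (mem-shifted x d)
          ≡⟨ Δg-cocycle fx ax (pairSums ps) (mem-shifted x d)
                        (excl ℛ Q fx ax (pairSums ps) (mem-shifted x d)) ⟩
        Δg fx (pairSums ps) (excl ℛ Q fx ax (pairSums ps) (mem-shifted x d))
          +R Δg fx (ax ∷ pairSums ps) (mem-shifted x d)
          ≡⟨ cong₂ _+R_ (trans (Δg-expand ps fx [] _) (sumSel-map (evalAt D' x d) pairs _))
                        (trans (Δg-expand ps fx (ax ∷ []) (mem-shifted x d))
                               (sumSel-map (evalAt D' x d) pairs _)) ⟩
        sumSel pairs (λ W s → composite D' f' W (mem-selection s) x d) +R S
          ≡⟨ cong (_+R S) (sumSel-split pairs (λ W s → composite D' f' W (mem-selection s) x d)) ⟩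
        (composite D' f' (map proj₁ pairs) (mem-selection (firsts pairs)) x d +R E) +R S
          ≡⟨ cong (λ z → (z +R E) +R S)
                  (Δg-cong refl (map-firsts-incrementPairs D hs pshs u x d)
                           (mem-selection (firsts pairs) x d) (mem x (down-closed D x u d))) ⟩
        (DR.restrict D (composite D f hs mem) u x d +R E) +R S
          ≡⟨ Cone.⊕-assoc R _ E S ⟩
        DR.restrict D (composite D f hs mem) u x d +R K x d ∎
        where
          open ≡-Reasoning
          fx ax : CQ
          fx = f' x d
          ax = a x d
          ps : Vec (CQ × CQ) p
          ps = evalPairsAt D' x d pairs
          E S : CR
          E  = sumSelExceptFirsts pairs (λ W s → composite D' f' W (mem-selection s) x d)
          S  = sumSel pairs (λ W s → composite D' f' (a ∷ W) (mem-a∷selection s) x d)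

      K-preStable :
        ∀ {n} →
        (∀ {k} (W : Vec (MapOn D' Q) k) → All (DQ.PreStableOn D') W → (memW : LandsInBall D' f' W) →
           DR.PreStableOfOrder D' (composite D' f' W memW) n) →
        DR.PreStableOfOrder D' K n
      K-preStable composite-preStable′ = DR.PreStableOfOrder-⊕ D'
        (DR.PreStableOfOrder-sumSelExceptFirsts D' pairs _ λ W s →
           composite-preStable′ W (Selection-All s pairs-preStable) (mem-selection s))
        (DR.PreStableOfOrder-sumSel D' pairs _ λ W s →
           composite-preStable′ (a ∷ W) (DQ.increment-preStable D f psf u ∷ Selection-All s pairs-preStable)
                                (mem-a∷selection s))
        where pairs-preStable = incrementPairs-preStable D hs pshs u

    composite-preStable : ∀ n (D : DownSet P) {p} (f : MapOn D Q) (hs : Vec (MapOn D Q) p) →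
                          DQ.PreStableOn D f → All (DQ.PreStableOn D) hs → (mem : LandsInBall D f hs) →
                          DR.PreStableOfOrder D (composite D f hs mem) n
    composite-preStable zero    D f hs psf pshs mem = DR.PreStableOfOrder-zero D (composite D f hs mem)
    composite-preStable (suc n) D f hs psf pshs mem =
      DR.PreStableOfOrder-suc D (composite D f hs mem) n λ u →
        let open CompositeIncrement D f hs psf pshs mem u in
        K , K-isIncrement ,
        K-preStable (λ W → composite-preStable n D' f' W (DQ.restrict-preStable D f psf u))

lemma4p25 : (ℛ : Reals) (P Q R : Cone ℛ) (p : ℕ)
    (f : Ball ℛ P → Cone.C Q) (hs : Vec (Ball ℛ P → Cone.C Q) p)
    (g : Ball ℛ Q → Cone.C R) →
    PreStable ℛ P Q f → All (PreStable ℛ P Q) hs → (pg : PreStable ℛ Q R g) →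
    (mem : (x : Ball ℛ P) → InBall ℛ Q (_+Σ_ ℛ Q (f x) (map (λ h → h x) hs))) →
    PreStable ℛ P R (λ x → Δ ℛ g pg (f x) (map (λ h → h x) hs) (mem x))
lemma4p25 ℛ P Q R p f hs g psf pshs pg mem =
  DR.PreStable-fromUnitBall λ n →
    DR.PreStableOfOrder-cong unitBall agree
      (composite-preStable n unitBall f′ hs′ (DQ.PreStable-onUnitBall psf)
         (All.map⁺ (All.map DQ.PreStable-onUnitBall pshs)) mem′)
  where
    open DownSets ℛ P
    open DifferenceCalculus ℛ Q R g pg using (InBallQ; _+ΣQ_; Δg-cong)
    open Composition ℛ P Q R g pg using (LandsInBall; composite; composite-preStable)
    module DQ = Differences Q
    module DR = Differences R

    f′ : MapOn unitBall Q
    f′ = DQ.onUnitBall f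

    hs′ : Vec (MapOn unitBall Q) p
    hs′ = map DQ.onUnitBall hs

    hs′-at : ∀ x .d → map (λ h → h x d) hs′ ≡ map (λ h → h (ball x d)) hs
    hs′-at x d = sym (map-∘ (λ h → h x d) DQ.onUnitBall hs)

    mem′ : LandsInBall unitBall f′ hs′
    mem′ x d = subst (λ vs → InBallQ (f (ball x d) +ΣQ vs)) (sym (hs′-at x d)) (mem (ball x d))

    agree : ∀ x .d → composite unitBall f′ hs′ mem′ x d
                       ≡ DR.onUnitBall (λ x → Δ ℛ g pg (f x) (map (λ h → h x) hs) (mem x)) x d
    agree x d = Δg-cong refl (hs′-at x d) (mem′ x d) (mem (ball x d))
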